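{- Let $k\ge2$ and $0\le r\le k-2$ be integers and let $B$ be the truncated augmented Heaviside sequence of mass $n=T_k+r$: $B_i=0$ for $i>T_{k-1}+1+r$, and for $1\le i\le T_{k-1}+1+r$, $B_i=2$ if $i=T_p+1$ for some $p\in\{1,\dots,k-1\}$ and $B_i=1$ otherwise. Then the depth of $B$ is exactly $T_k+k(k-r-2)=3T_{k-1}-rk$.
   Context: $T_j=j(j+1)/2$. A mancala configuration is $\lambda:\mathbb N^*\to\mathbb N$ with support $\{1,\dots,\ell\}$ for some $\ell\ge0$. Move $\Phi$: $\mu=\Phi(\lambda)$, $\mu_i=\lambda_{i+1}+1$ for $1\le i\le\lambda_1$, $\mu_i=\lambda_{i+1}$ for $i>\lambda_1$; $\Phi^t$ its iterate. Componentwise order; $\lambda<\mu$ means $\lambda\le\mu$, $\lambda\ne\mu$. Marching group $M^j_i=j-i+1$ for $i\le j$, $0$ otherwise. Augmented marching group: mancala $\lambda$ with $M^j\le\lambda<M^{j+1}$ for some $j\ge0$. Depth of $\lambda$: least $t\ge0$ with $\Phi^t(\lambda)$ an augmented marching group. -}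

module Defs where

open import Data.Nat using (ℕ; zero; suc; _+_; _*_; _∸_; _≤_; _<_; _≤ᵇ_)
open import Data.Bool using (Bool; true; false; if_then_else_)
open import Data.Product using (Σ; _×_; ∃-syntax)
open import Relation.Nullary using (¬_)
open import Relation.Binary.PropositionalEquality using (_≡_)

T : ℕ → ℕ
T zero = zero
T (suc j) = T j + suc j

-- A sequence λ : ℕ* → ℕ, represented as ℕ → ℕ indexed from 1 (value at 0 is ignored).
Seq : Set
Seq = ℕ → ℕ

IsMancala : Seq → Set
IsMancala λ′ = ∃[ ℓ ] ((∀ i → 1 ≤ i → i ≤ ℓ → 1 ≤ λ′ i) × (∀ i → ℓ < i → λ′ i ≡ 0))

Φ : Seq → Seq
Φ λ′ i = if (i ≤ᵇ λ′ 1) then λ′ (suc i) + 1 else λ′ (suc i)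

Φ^ : ℕ → Seq → Seq
Φ^ zero λ′ = λ′
Φ^ (suc t) λ′ = Φ (Φ^ t λ′)

_≤ₛ_ : Seq → Seq → Set
λ′ ≤ₛ μ = ∀ i → 1 ≤ i → λ′ i ≤ μ i

_≡ₛ_ : Seq → Seq → Set
λ′ ≡ₛ μ = ∀ i → 1 ≤ i → λ′ i ≡ μ i

_<ₛ_ : Seq → Seq → Set
λ′ <ₛ μ = (λ′ ≤ₛ μ) × ¬ (λ′ ≡ₛ μ)

M : ℕ → Seq
M j i = if (i ≤ᵇ j) then suc j ∸ i else 0

IsAMG : Seq → Set
IsAMG λ′ = IsMancala λ′ × ∃[ j ] ((M j ≤ₛ λ′) × (λ′ <ₛ M (suc j)))

HasDepth : Seq → ℕ → Set
HasDepth λ′ d = IsAMG (Φ^ d λ′) × (∀ t → t < d → ¬ IsAMG (Φ^ t λ′))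

isTriPlusOne : ℕ → ℕ → Bool
isTriPlusOne zero i = false
isTriPlusOne (suc zero) i = false
isTriPlusOne (suc (suc m)) i =
  if (i ≤ᵇ T (suc m) + 1) ∧ (T (suc m) + 1 ≤ᵇ i) then true else isTriPlusOne (suc m) i
  where open import Data.Bool using (_∧_)

B : ℕ → ℕ → Seq
B k r i =
  if (1 ≤ᵇ i) ∧ (i ≤ᵇ T (k ∸ 1) + 1 + r)
  then (if isTriPlusOne k i then 2 else 1)
  else 0
  where open import Data.Bool using (_∧_)

-- Write k = K + 2 with K = r + w.  Read as a list, B is 1, 2, 1, 2, 1, 1, 2, … followed by
-- r ones.  For T_K moves the configuration is a staircase with a dip (a descending run, an
-- ascent s + 1 < s + 2, a descending run down to 2) followed by the untouched part of B:
-- each move sows the head along the staircase and turns the next 1 of B into a 2.  The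
-- ascent rules out an augmented marching group.  After r more moves, which absorb the
-- trailing ones, the configuration is M^(K+1) + D + E, where D is 1 on positions 1, …, K + 2
-- except for a single hole, and E is the indicator of a band of r + 1 consecutive positions.
-- Every further move rotates D and E one place to the left, D with period K + 2 and E with
-- period K + 3.  While the hole of D sits on a zero of E the configuration is below M^(K+2)
-- at the hole and above it on the band, so it is not an augmented marching group.  The hole
-- reaches the last position after w + 1 moves and again after every K + 2 further moves,
-- each such round shifting the band one place to the right; after w + 1 rounds the band ends
-- at position K + 2, and M^(K+1) + D + E lies between M^(K+2) and M^(K+3).  This takes
-- T_K + r + (w + 1)(K + 3) = T_k + k(k − r − 2) moves.

module Submission where

open import Defs
open import Data.Bool using (true; false; if_then_else_; _∧_)
open import Data.Empty using (⊥-elim)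
open import Data.List using (List; []; _∷_; _++_; _∷ʳ_; length; replicate; initLast; _∷ʳ′_)
open import Data.List.Properties using (++-assoc; ++-identityʳ; ∷ʳ-++; length-++; length-replicate)
open import Data.Nat using (ℕ; zero; suc; _+_; _*_; _∸_; _≤_; _<_; _≤′_; ≤′-refl; ≤′-step; _≤ᵇ_; z≤n; s≤s; s≤s⁻¹; _≤?_; _<?_)
open import Data.Nat.Properties
open import Data.Nat.Tactic.RingSolver using (solve-∀; solve)
open import Data.Product using (_×_; _,_; ∃-syntax)
open import Data.Sum using (inj₁; inj₂)
open import Relation.Binary.Definitions using (tri<; tri≈; tri>)
open import Relation.Binary.PropositionalEquality
open import Relation.Nullary using (¬_; yes; no)
open import Relation.Nullary.Decidable using (dec-true; dec-false)

≤⇒≤ᵇ≡true : ∀ {m n} → m ≤ n → (m ≤ᵇ n) ≡ true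
≤⇒≤ᵇ≡true {m} {n} = dec-true (m ≤? n)

>⇒≤ᵇ≡false : ∀ {m n} → n < m → (m ≤ᵇ n) ≡ false
>⇒≤ᵇ≡false {m} {n} n<m = dec-false (m ≤? n) (<⇒≱ n<m)

M≡∸ : ∀ j i → M j i ≡ suc j ∸ i
M≡∸ j i with i ≤? j
... | yes i≤j rewrite ≤⇒≤ᵇ≡true i≤j = refl
... | no i≰j rewrite >⇒≤ᵇ≡false (≰⇒> i≰j) = sym (m≤n⇒m∸n≡0 (≰⇒> i≰j))

M-mono : ∀ {j j′} i → j ≤ j′ → M j i ≤ M j′ i
M-mono {j} {j′} i j≤j′ rewrite M≡∸ j i | M≡∸ j′ i = ∸-monoˡ-≤ i (s≤s j≤j′)

Φ-below : ∀ λ′ i → i ≤ λ′ 1 → Φ λ′ i ≡ λ′ (suc i) + 1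
Φ-below λ′ i i≤ rewrite ≤⇒≤ᵇ≡true i≤ = refl

Φ-above : ∀ λ′ i → λ′ 1 < i → Φ λ′ i ≡ λ′ (suc i)
Φ-above λ′ i >i rewrite >⇒≤ᵇ≡false >i = refl

Φ-past-head : ∀ λ′ j h q → λ′ 1 ≡ j + h →
  Φ λ′ (suc (j + q)) ≡ λ′ (suc (suc (j + q))) + (if suc q ≤ᵇ h then 1 else 0)
Φ-past-head λ′ j h q λ₁≡j+h with suc q ≤? h
... | yes q<h rewrite ≤⇒≤ᵇ≡true q<h =
  Φ-below λ′ _ (subst (suc (j + q) ≤_) (sym λ₁≡j+h) (≤-trans (≤-reflexive (sym (+-suc j q))) (+-monoʳ-≤ j q<h)))
... | no q≮h rewrite >⇒≤ᵇ≡false (≰⇒> q≮h) =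
  trans (Φ-above λ′ _ (subst (_< suc (j + q)) (sym λ₁≡j+h) (s≤s (+-monoʳ-≤ j (≮⇒≥ q≮h)))))
        (sym (+-identityʳ _))

Φ-resp-≡ₛ : ∀ {λ′ μ} → λ′ ≡ₛ μ → Φ λ′ ≡ₛ Φ μ
Φ-resp-≡ₛ e i 1≤i rewrite e 1 (s≤s z≤n) | e (suc i) (s≤s z≤n) = refl

≡ₛ-trans : ∀ {λ′ μ ν} → λ′ ≡ₛ μ → μ ≡ₛ ν → λ′ ≡ₛ ν
≡ₛ-trans e f i 1≤i = trans (e i 1≤i) (f i 1≤i)

≡ₛ-sym : ∀ {λ′ μ} → λ′ ≡ₛ μ → μ ≡ₛ λ′
≡ₛ-sym e i 1≤i = sym (e i 1≤i)

m+[1+n]≡o⇒m<o : ∀ {m n o} → m + suc n ≡ o → m < o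
m+[1+n]≡o⇒m<o {m} {n} m+1+n≡o = ≤-trans (m≤m+n (suc m) n) (≤-reflexive (trans (sym (+-suc m n)) m+1+n≡o))

-- Configurations as lists

infixl 9 _!_
_!_ : List ℕ → ℕ → ℕ
[] ! _ = 0
(x ∷ xs) ! zero = x
(x ∷ xs) ! suc i = xs ! i

toSeq : List ℕ → Seq
toSeq xs zero = 0
toSeq xs (suc i) = xs ! i

!-++ˡ : ∀ xs ys {i} → i < length xs → (xs ++ ys) ! i ≡ xs ! i
!-++ˡ (x ∷ xs) ys {zero} _ = refl
!-++ˡ (x ∷ xs) ys {suc i} (s≤s i<) = !-++ˡ xs ys i<

!-++ʳ : ∀ xs ys i → (xs ++ ys) ! (length xs + i) ≡ ys ! i
!-++ʳ [] ys i = refl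
!-++ʳ (x ∷ xs) ys i = !-++ʳ xs ys i

!-++ʳ-length : ∀ xs ys {n} i → length xs ≡ n → (xs ++ ys) ! (n + i) ≡ ys ! i
!-++ʳ-length xs ys i refl = !-++ʳ xs ys i

!-++-length : ∀ xs ys {n} → length xs ≡ n → (xs ++ ys) ! n ≡ ys ! 0
!-++-length xs ys refl = trans (cong ((xs ++ ys) !_) (sym (+-identityʳ _))) (!-++ʳ xs ys 0)

!-beyond : ∀ xs {i} → length xs ≤ i → xs ! i ≡ 0
!-beyond [] _ = refl
!-beyond (x ∷ xs) {suc i} (s≤s le) = !-beyond xs le

!≢0⇒< : ∀ xs {i} → xs ! i ≢ 0 → i < length xs
!≢0⇒< xs {i} ne with i <? length xs
... | yes i< = i<
... | no i≮ = ⊥-elim (ne (!-beyond xs (≮⇒≥ i≮)))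

!-replicate : ∀ n x {i} → i < n → replicate n x ! i ≡ x
!-replicate (suc n) x {zero} _ = refl
!-replicate (suc n) x {suc i} (s≤s i<) = !-replicate n x i<

!-replicate-0 : ∀ n i → replicate n 0 ! i ≡ 0
!-replicate-0 zero i = refl
!-replicate-0 (suc n) zero = refl
!-replicate-0 (suc n) (suc i) = !-replicate-0 n i

replicate-snoc : ∀ n (x : ℕ) → replicate n x ++ x ∷ [] ≡ replicate (suc n) x
replicate-snoc zero x = refl
replicate-snoc (suc n) x = cong (x ∷_) (replicate-snoc n x)

!-replicate-++ˡ : ∀ n (x : ℕ) ys {i} → i < n → (replicate n x ++ ys) ! i ≡ x
!-replicate-++ˡ (suc n) x ys {zero} _ = refl
!-replicate-++ˡ (suc n) x ys {suc i} (s≤s i<n) = !-replicate-++ˡ n x ys i<n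

!-replicate-++ : ∀ n (x : ℕ) ys → (replicate n x ++ ys) ! n ≡ ys ! 0
!-replicate-++ zero x ys = refl
!-replicate-++ (suc n) x ys = !-replicate-++ n x ys

!-replicate-++ʳ : ∀ n (x : ℕ) ys i → (replicate n x ++ ys) ! (n + i) ≡ ys ! i
!-replicate-++ʳ zero x ys i = refl
!-replicate-++ʳ (suc n) x ys i = !-replicate-++ʳ n x ys i

sow : ℕ → List ℕ → List ℕ
sow zero xs = xs
sow (suc n) [] = 1 ∷ sow n []
sow (suc n) (x ∷ xs) = suc x ∷ sow n xs

move : List ℕ → List ℕ
move [] = []
move (x ∷ xs) = sow x xs

!-sow : ∀ n xs i → sow n xs ! i ≡ (if suc i ≤ᵇ n then xs ! i + 1 else xs ! i)
!-sow zero xs i = refl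
!-sow (suc n) [] zero = refl
!-sow (suc n) [] (suc i) = !-sow n [] i
!-sow (suc n) (x ∷ xs) zero = +-comm 1 x
!-sow (suc n) (x ∷ xs) (suc i) = !-sow n xs i

Φ-toSeq : ∀ xs → Φ (toSeq xs) ≡ₛ toSeq (move xs)
Φ-toSeq [] (suc i) _ = refl
Φ-toSeq (x ∷ xs) (suc i) _ = sym (!-sow x xs i)

Φ-toSeq-≡ : ∀ {xs ys} → move xs ≡ ys → Φ (toSeq xs) ≡ₛ toSeq ys
Φ-toSeq-≡ {xs} refl = Φ-toSeq xs

-- Recognising augmented marching groups

IsAMG-resp-≡ₛ : ∀ {λ′ μ} → λ′ ≡ₛ μ → IsAMG λ′ → IsAMG μ
IsAMG-resp-≡ₛ e ((ℓ , pos , zer) , j , lo , hi , ne) =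
  (ℓ , (λ i 1≤i i≤ℓ → subst (1 ≤_) (e i 1≤i) (pos i 1≤i i≤ℓ))
     , (λ i ℓ<i → trans (sym (e i (≤-trans (s≤s z≤n) ℓ<i))) (zer i ℓ<i)))
  , j , (λ i 1≤i → subst (M j i ≤_) (e i 1≤i) (lo i 1≤i))
      , (λ i 1≤i → subst (_≤ M (suc j) i) (e i 1≤i) (hi i 1≤i))
      , (λ μ≡M → ne (≡ₛ-trans e μ≡M))

IsAMG⇒nonincreasing : ∀ {λ′} → IsAMG λ′ → ∀ i → 1 ≤ i → λ′ (suc i) ≤ λ′ i
IsAMG⇒nonincreasing {λ′} (_ , j , lo , hi , _) i 1≤i = begin
  λ′ (suc i)        ≤⟨ hi (suc i) (s≤s z≤n) ⟩
  M (suc j) (suc i) ≡⟨ trans (M≡∸ (suc j) (suc i)) (sym (M≡∸ j i)) ⟩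
  M j i             ≤⟨ lo i 1≤i ⟩
  λ′ i              ∎
  where open ≤-Reasoning

ascent⇒¬IsAMG : ∀ xs {x y} ys → x < y → ¬ IsAMG (toSeq (xs ++ x ∷ y ∷ ys))
ascent⇒¬IsAMG xs {x} {y} ys x<y amg =
  <⇒≱ x<y (subst₂ _≤_ at-y at-x (IsAMG⇒nonincreasing amg (suc (length xs)) (s≤s z≤n)))
  where
  at-x : toSeq (xs ++ x ∷ y ∷ ys) (suc (length xs)) ≡ x
  at-x = !-++-length xs (x ∷ y ∷ ys) refl
  at-y : toSeq (xs ++ x ∷ y ∷ ys) (suc (suc (length xs))) ≡ y
  at-y = trans (cong ((xs ++ x ∷ y ∷ ys) !_) (+-comm 1 (length xs))) (!-++ʳ xs (x ∷ y ∷ ys) 1)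

straddle⇒¬IsAMG : ∀ {λ′} j {h p} → 1 ≤ h → 1 ≤ p → λ′ h < M j h → M j p < λ′ p → ¬ IsAMG λ′
straddle⇒¬IsAMG j {h} {p} 1≤h 1≤p below above (_ , j′ , lo , hi , _) with j ≤? j′
... | yes j≤j′ = <⇒≱ below (≤-trans (M-mono h j≤j′) (lo h 1≤h))
... | no j≰j′ = <⇒≱ above (≤-trans (hi p 1≤p) (M-mono p (≰⇒> j≰j′)))

-- staircasePlus j c is M^j + c, with c indexed from 0.
staircasePlus : ℕ → (ℕ → ℕ) → Seq
staircasePlus j c zero = 0
staircasePlus j c (suc p) = (j ∸ p) + c p

staircasePlus-IsAMG : ∀ j c → (∀ p → p ≤ j → 1 ≤ c p) → (∀ p → c p ≤ 2) → (∀ p → j < p → c p ≡ 0) →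
  IsAMG (staircasePlus j c)
staircasePlus-IsAMG j c pos ≤2 vanish =
  (suc j , positive , vanishing) , suc j , above-M , below-M , ≢M
  where
  beyond : ∀ p → j < p → staircasePlus j c (suc p) ≡ 0
  beyond p j<p rewrite m≤n⇒m∸n≡0 (<⇒≤ j<p) = vanish p j<p
  positive : ∀ i → 1 ≤ i → i ≤ suc j → 1 ≤ staircasePlus j c i
  positive (suc p) _ (s≤s p≤j) = ≤-trans (pos p p≤j) (m≤n+m (c p) (j ∸ p))
  vanishing : ∀ i → suc j < i → staircasePlus j c i ≡ 0
  vanishing (suc p) (s≤s j<p) = beyond p j<p
  above-M : M (suc j) ≤ₛ staircasePlus j c
  above-M (suc p) _ rewrite M≡∸ (suc j) (suc p) with p ≤? j
  ... | yes p≤j = ≤-trans (≤-reflexive (trans (+-∸-assoc 1 p≤j) (+-comm 1 (j ∸ p)))) (+-monoʳ-≤ (j ∸ p) (pos p p≤j))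
  ... | no p≰j rewrite m≤n⇒m∸n≡0 (≰⇒> p≰j) = z≤n
  below-M : staircasePlus j c ≤ₛ M (suc (suc j))
  below-M (suc p) _ rewrite M≡∸ (suc (suc j)) (suc p) with p ≤? j
  ... | yes p≤j = ≤-trans (+-monoʳ-≤ (j ∸ p) (≤2 p)) (≤-reflexive (trans (+-comm (j ∸ p) 2) (sym (+-∸-assoc 2 p≤j))))
  ... | no p≰j rewrite beyond p (≰⇒> p≰j) = z≤n
  ≢M : ¬ (staircasePlus j c ≡ₛ M (suc (suc j)))
  ≢M eq = 0≢1+n (begin
    0                                      ≡⟨ sym (beyond (suc j) ≤-refl) ⟩
    staircasePlus j c (suc (suc j))        ≡⟨ eq (suc (suc j)) (s≤s z≤n) ⟩
    M (suc (suc j)) (suc (suc j))          ≡⟨ M≡∸ (suc (suc j)) (suc (suc j)) ⟩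
    suc (suc (suc j)) ∸ suc (suc j)        ≡⟨ +-∸-assoc 1 (≤-refl {suc (suc j)}) ⟩
    1 + (suc (suc j) ∸ suc (suc j))        ≡⟨ cong suc (n∸n≡0 (suc (suc j))) ⟩
    1                                      ∎)
    where open ≡-Reasoning

-- Runs of Φ avoiding augmented marching groups

infix 4 _↦_
_↦_ : Seq → Seq → Set
λ′ ↦ μ = ¬ IsAMG λ′ × Φ λ′ ≡ₛ μ

↦-≡ₛ : ∀ {λ′ μ ν} → λ′ ↦ μ → μ ≡ₛ ν → λ′ ↦ ν
↦-≡ₛ (¬amg , Φλ≡μ) μ≡ν = ¬amg , ≡ₛ-trans Φλ≡μ μ≡ν

module Run (λ₀ : Seq) where

  Reached : ℕ → Seq → Set
  Reached t μ = (Φ^ t λ₀ ≡ₛ μ) × (∀ s → s < t → ¬ IsAMG (Φ^ s λ₀))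

  start : ∀ {μ} → λ₀ ≡ₛ μ → Reached 0 μ
  start e = e , λ _ ()

  step : ∀ {t μ ν} → Reached t μ → μ ↦ ν → Reached (suc t) ν
  step {t} (e , before) (¬amg , Φμ≡ν) = ≡ₛ-trans (Φ-resp-≡ₛ e) Φμ≡ν , earlier
    where
    earlier : ∀ s → s < suc t → ¬ IsAMG (Φ^ s λ₀)
    earlier s (s≤s s≤t) with m≤n⇒m<n∨m≡n s≤t
    ... | inj₁ s<t = before s s<t
    ... | inj₂ refl = λ amg → ¬amg (IsAMG-resp-≡ₛ e amg)

  retime : ∀ {t t′ μ} → t ≡ t′ → Reached t μ → Reached t′ μ
  retime refl R = R

  run : (L : ℕ) (S : ℕ → ℕ → Seq) {c : ℕ} →
    (∀ {a s t} → suc a + s ≡ c → Reached t (S (suc a) s) → Reached (t + L) (S a (suc s))) →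
    ∀ {a s t} → a + s ≡ c → Reached t (S a s) → Reached (t + a * L) (S 0 c)
  run L S round {zero} {t = t} refl R = retime (sym (+-identityʳ t)) R
  run L S round {suc a} {s} {t} a+s≡c R =
    retime (+-assoc t L (a * L)) (run L S round (trans (+-suc a s) a+s≡c) (round a+s≡c R))

  march : (S : ℕ → ℕ → Seq) {c : ℕ} →
    (∀ {a s} → suc a + s ≡ c → S (suc a) s ↦ S a (suc s)) →
    ∀ {a s t} → a + s ≡ c → Reached t (S a s) → Reached (t + a) (S 0 c)
  march S {c} moves {a} {t = t} a+s≡c R =
    retime (cong (t +_) (*-identityʳ a)) (run 1 S one-step a+s≡c R)
    where
    one-step : ∀ {a s t} → suc a + s ≡ c → Reached t (S (suc a) s) → Reached (t + 1) (S a (suc s))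
    one-step {t = t} e R = retime (+-comm 1 t) (step R (moves e))

  Reached-≡ₛ : ∀ {t μ ν} → Reached t μ → μ ≡ₛ ν → Reached t ν
  Reached-≡ₛ (e , before) μ≡ν = ≡ₛ-trans e μ≡ν , before

  Reached⇒HasDepth : ∀ {d μ} → Reached d μ → IsAMG μ → HasDepth λ₀ d
  Reached⇒HasDepth (e , before) amg = IsAMG-resp-≡ₛ (≡ₛ-sym e) amg , before

-- The Heaviside sequence

T-mono-≤ : ∀ {p q} → p ≤ q → T p ≤ T q
T-mono-≤ z≤n = z≤n
T-mono-≤ (s≤s p≤q) = +-mono-≤ (T-mono-≤ p≤q) (s≤s p≤q)

after-markers : ∀ {q i} → T q + 1 < i → ∀ {p} → p ≤ q → i ≢ T p + 1
after-markers T[q]+1<i p≤q refl = <-irrefl refl (≤-<-trans (+-monoˡ-≤ 1 (T-mono-≤ p≤q)) T[q]+1<i)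

between-markers : ∀ {q i} → T q + 1 < i → i < T (suc q) + 1 → ∀ p → i ≢ T p + 1
between-markers {q} lo hi p with p ≤? q
... | yes p≤q = after-markers lo p≤q
... | no p≰q = λ { refl → <-irrefl refl (<-≤-trans hi (+-monoˡ-≤ 1 (T-mono-≤ (≰⇒> p≰q)))) }

≤ᵇ∧≥ᵇ-refl : ∀ n → ((n ≤ᵇ n) ∧ (n ≤ᵇ n)) ≡ true
≤ᵇ∧≥ᵇ-refl n rewrite ≤⇒≤ᵇ≡true (≤-refl {n}) = refl

≤ᵇ∧≥ᵇ-≢ : ∀ {i n} → i ≢ n → ((i ≤ᵇ n) ∧ (n ≤ᵇ i)) ≡ false
≤ᵇ∧≥ᵇ-≢ {i} {n} i≢n with <-cmp i n
... | tri< i<n _ _ rewrite ≤⇒≤ᵇ≡true (<⇒≤ i<n) | >⇒≤ᵇ≡false i<n = refl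
... | tri≈ _ i≡n _ = ⊥-elim (i≢n i≡n)
... | tri> _ _ n<i rewrite >⇒≤ᵇ≡false n<i = refl

if-then-true : ∀ b {c} → c ≡ true → (if b then true else c) ≡ true
if-then-true true _ = refl
if-then-true false c≡true = c≡true

isTriPlusOne-marker : ∀ k {p} → 1 ≤ p → p < k → isTriPlusOne k (T p + 1) ≡ true
isTriPlusOne-marker (suc m) 1≤p p<1+m = go 1≤p (≤⇒≤′ (s≤s⁻¹ p<1+m))
  where
  go : ∀ {m p} → 1 ≤ p → p ≤′ m → isTriPlusOne (suc m) (T p + 1) ≡ true
  go {zero} () ≤′-refl
  go {suc m} {p} _ ≤′-refl = cong (λ b → if b then true else isTriPlusOne (suc m) (T p + 1)) (≤ᵇ∧≥ᵇ-refl (T p + 1))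
  go {suc m} 1≤p (≤′-step p≤′m) = if-then-true _ (go 1≤p p≤′m)

isTriPlusOne-other : ∀ k {i} → (∀ p → 1 ≤ p → p < k → i ≢ T p + 1) → isTriPlusOne k i ≡ false
isTriPlusOne-other zero _ = refl
isTriPlusOne-other (suc zero) _ = refl
isTriPlusOne-other (suc (suc m)) {i} no-marker =
  trans (cong (λ b → if b then true else isTriPlusOne (suc m) i) (≤ᵇ∧≥ᵇ-≢ (no-marker (suc m) (s≤s z≤n) ≤-refl)))
        (isTriPlusOne-other (suc m) (λ p 1≤p p<1+m → no-marker p 1≤p (m<n⇒m<1+n p<1+m)))

blocks : ℕ → ℕ → ℕ → List ℕ
blocks r q zero = replicate r 1
blocks r q (suc n) = replicate q 1 ++ 2 ∷ blocks r (suc q) n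

module Heaviside (K r : ℕ) where

  private
    k N : ℕ
    k = suc (suc K)
    N = T (suc K) + 1 + r

  B-inside : ∀ {i} → suc i ≤ N → B k r (suc i) ≡ (if isTriPlusOne k (suc i) then 2 else 1)
  B-inside {i} i<N = cong (λ b → if b then (if isTriPlusOne k (suc i) then 2 else 1) else 0) (≤⇒≤ᵇ≡true i<N)

  B-plain : ∀ {i} → suc i ≤ N → (∀ p → 1 ≤ p → p < k → suc i ≢ T p + 1) → B k r (suc i) ≡ 1
  B-plain i<N no-marker =
    trans (B-inside i<N) (cong (λ b → if b then 2 else 1) (isTriPlusOne-other k no-marker))

  B-marker : ∀ {p} → 1 ≤ p → p < k → B k r (T p + 1) ≡ 2
  B-marker {p} 1≤p p<k = begin
    B k r (T p + 1)                                       ≡⟨ cong (B k r) (+-comm (T p) 1) ⟩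
    B k r (suc (T p))                                     ≡⟨ B-inside (≤-trans (≤-reflexive (+-comm 1 (T p))) marker≤N) ⟩
    (if isTriPlusOne k (suc (T p)) then 2 else 1)         ≡⟨ cong (λ i → if isTriPlusOne k i then 2 else 1) (+-comm 1 (T p)) ⟩
    (if isTriPlusOne k (T p + 1) then 2 else 1)           ≡⟨ cong (λ b → if b then 2 else 1) (isTriPlusOne-marker k 1≤p p<k) ⟩
    2                                                     ∎
    where
    open ≡-Reasoning
    marker≤N : T p + 1 ≤ N
    marker≤N = ≤-trans (+-monoˡ-≤ 1 (T-mono-≤ (s≤s⁻¹ p<k))) (m≤m+n _ r)

  B-beyond : ∀ {i} → N < suc i → B k r (suc i) ≡ 0
  B-beyond {i} N<i = cong (λ b → if b then (if isTriPlusOne k (suc i) then 2 else 1) else 0) (>⇒≤ᵇ≡false N<i)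

  private
    past-marker : ∀ t x → t + 1 < suc (suc (t + x))
    past-marker t x = s≤s (≤-trans (≤-reflexive (+-comm t 1)) (s≤s (m≤m+n t x)))

    at-marker : ∀ t q → suc (suc (t + q)) ≡ t + suc q + 1
    at-marker t q = solve (t ∷ q ∷ [])

    within : ∀ t {x n} → x < n → suc (suc (t + x)) ≤ t + 1 + n
    within t {x} {n} x<n = begin
      suc (suc (t + x)) ≡⟨ solve (t ∷ x ∷ []) ⟩
      t + 1 + suc x     ≤⟨ +-monoʳ-≤ (t + 1) x<n ⟩
      t + 1 + n         ∎
      where open ≤-Reasoning

    not-within : ∀ t {x n} → n ≤ x → t + 1 + n < suc (suc (t + x))
    not-within t {x} {n} n≤x = begin-strict
      t + 1 + n         ≤⟨ +-monoʳ-≤ (t + 1) n≤x ⟩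
      t + 1 + x         <⟨ ≤-refl ⟩
      suc (t + 1 + x)   ≡⟨ solve (t ∷ x ∷ []) ⟩
      suc (suc (t + x)) ∎
      where open ≤-Reasoning

    before-next : ∀ t {x q} → x < q → suc (suc (t + x)) < t + suc q + 1
    before-next t {x} {q} x<q = begin-strict
      suc (suc (t + x)) ≡⟨ solve (t ∷ x ∷ []) ⟩
      t + suc x + 1     <⟨ +-monoˡ-< 1 (+-monoʳ-< t (s≤s x<q)) ⟩
      t + suc q + 1     ∎
      where open ≤-Reasoning

  B≡blocks : ∀ n q → q + n ≡ suc K → ∀ x → B k r (suc (suc (T q + x))) ≡ blocks r q n ! x
  B≡blocks zero q q+0≡1+K x with trans (sym (+-identityʳ q)) q+0≡1+K
  ... | refl with x <? r
  ...   | yes x<r = trans (B-plain (within (T q) x<r) (λ p _ p<k → after-markers (past-marker (T q) x) (s≤s⁻¹ p<k)))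
                          (sym (!-replicate r 1 x<r))
  ...   | no x≮r = trans (B-beyond (not-within (T q) (≮⇒≥ x≮r)))
                         (sym (!-beyond (replicate r 1) (≤-trans (≤-reflexive (length-replicate r)) (≮⇒≥ x≮r))))
  B≡blocks (suc n) q q+1+n≡1+K x with <-cmp x q
  ... | tri< x<q _ _ = trans (B-plain inside (λ p _ _ → between-markers (past-marker (T q) x) (before-next (T q) x<q) p))
                             (sym (!-replicate-++ˡ q 1 _ x<q))
    where
    inside : suc (suc (T q + x)) ≤ N
    inside = ≤-trans (<⇒≤ (before-next (T q) x<q)) (≤-trans (+-monoˡ-≤ 1 (T-mono-≤ (m+[1+n]≡o⇒m<o q+1+n≡1+K))) (m≤m+n _ r))
  ... | tri≈ _ refl _ = trans (cong (B k r) (at-marker (T x) x))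
                        (trans (B-marker (s≤s z≤n) (s≤s (m+[1+n]≡o⇒m<o q+1+n≡1+K))) (sym (!-replicate-++ x 1 _)))
  ... | tri> _ _ q<x with m≤n⇒∃[o]m+o≡n q<x
  ...   | y , refl = begin
    B k r (suc (suc (T q + (suc q + y))))  ≡⟨ cong (λ i → B k r (suc (suc i))) (sym (+-assoc (T q) (suc q) y)) ⟩
    B k r (suc (suc (T (suc q) + y)))      ≡⟨ B≡blocks n (suc q) (trans (sym (+-suc q n)) q+1+n≡1+K) y ⟩
    blocks r (suc q) n ! y                 ≡⟨ sym (!-replicate-++ʳ q 1 (2 ∷ blocks r (suc q) n) (suc y)) ⟩
    blocks r q (suc n) ! (q + suc y)       ≡⟨ cong (blocks r q (suc n) !_) (+-suc q y) ⟩
    blocks r q (suc n) ! (suc q + y)       ∎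
    where open ≡-Reasoning

  B≡toSeq-blocks : B k r ≡ₛ toSeq (1 ∷ blocks r 0 (suc K))
  B≡toSeq-blocks (suc zero) _ =
    B-plain (≤-trans (m≤n+m 1 (T (suc K))) (m≤m+n _ r)) (λ p 1≤p _ 1≡ → <-irrefl 1≡ (+-monoˡ-≤ 1 (T-mono-≤ 1≤p)))
  B≡toSeq-blocks (suc (suc x)) _ = B≡blocks (suc K) 0 refl x

-- The staircase with a dip

stairs : ℕ → ℕ → List ℕ
stairs b zero = []
stairs b (suc n) = suc (b + n) ∷ stairs b n

length-stairs : ∀ b n → length (stairs b n) ≡ n
length-stairs b zero = refl
length-stairs b (suc n) = cong suc (length-stairs b n)

!-stairs : ∀ b n {i} → i < n → stairs b n ! i ≡ b + n ∸ i
!-stairs b (suc n) {zero} _ = sym (+-suc b n)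
!-stairs b (suc n) {suc i} (s≤s i<n) rewrite +-suc b n = !-stairs b n i<n

sow-stairs : ∀ b n m ys → sow (n + m) (stairs b n ++ ys) ≡ stairs (suc b) n ++ sow m ys
sow-stairs b zero m ys = refl
sow-stairs b (suc n) m ys = cong (suc (suc (b + n)) ∷_) (sow-stairs b n m ys)

stairs-snoc : ∀ b n ys → stairs (suc b) n ++ suc b ∷ ys ≡ stairs b (suc n) ++ ys
stairs-snoc b zero ys = cong (λ x → suc x ∷ ys) (sym (+-identityʳ b))
stairs-snoc b (suc n) ys = cong₂ _∷_ (cong suc (sym (+-suc b n))) (stairs-snoc b n ys)

dip : ℕ → ℕ → List ℕ → List ℕ
dip a s t = stairs (suc (suc s)) a ++ suc s ∷ stairs 1 (suc s) ++ t

dip-¬IsAMG : ∀ a s t → ¬ IsAMG (toSeq (dip a s t))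
dip-¬IsAMG a s t = ascent⇒¬IsAMG (stairs (suc (suc s)) a) (stairs 1 s ++ t) (n<1+n (suc s))

dip-step : ∀ a s t → move (dip (suc a) s (1 ∷ t)) ≡ dip a (suc s) t
dip-step a s t = begin
  sow (suc (suc (suc s) + a)) (stairs (suc (suc s)) a ++ suc s ∷ stairs 1 (suc s) ++ 1 ∷ t)
    ≡⟨ cong (λ h → sow h (stairs (suc (suc s)) a ++ suc s ∷ stairs 1 (suc s) ++ 1 ∷ t)) (solve (s ∷ a ∷ [])) ⟩
  sow (a + suc (suc s + 1)) (stairs (suc (suc s)) a ++ suc s ∷ stairs 1 (suc s) ++ 1 ∷ t)
    ≡⟨ sow-stairs (suc (suc s)) a _ _ ⟩
  stairs (suc (suc (suc s))) a ++ suc (suc s) ∷ sow (suc s + 1) (stairs 1 (suc s) ++ 1 ∷ t)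
    ≡⟨ cong (λ ys → stairs (suc (suc (suc s))) a ++ suc (suc s) ∷ ys) (sow-stairs 1 (suc s) 1 (1 ∷ t)) ⟩
  stairs (suc (suc (suc s))) a ++ suc (suc s) ∷ stairs 2 (suc s) ++ 2 ∷ t
    ≡⟨ cong (λ ys → stairs (suc (suc (suc s))) a ++ suc (suc s) ∷ ys) (stairs-snoc 1 (suc s) t) ⟩
  dip a (suc s) t ∎
  where open ≡-Reasoning

dip-end : ∀ s t → move (dip 0 s (1 ∷ 2 ∷ t)) ≡ dip (suc s) 0 t
dip-end s t = begin
  sow (suc s) (stairs 1 (suc s) ++ 1 ∷ 2 ∷ t)
    ≡⟨ cong (λ h → sow h (stairs 1 (suc s) ++ 1 ∷ 2 ∷ t)) (sym (+-identityʳ (suc s))) ⟩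
  sow (suc s + 0) (stairs 1 (suc s) ++ 1 ∷ 2 ∷ t)
    ≡⟨ sow-stairs 1 (suc s) 0 _ ⟩
  dip (suc s) 0 t ∎
  where open ≡-Reasoning

module Climbing (K r : ℕ) where
  open Run (B (suc (suc K)) r)

  climb : ∀ j R {t} → Reached t (toSeq (dip j 0 (replicate (suc j) 1 ++ 2 ∷ R))) →
    Reached (t + suc j) (toSeq (dip (suc j) 0 R))
  climb j R {t} reached =
    retime (sym (+-suc t j))
      (step (march S moves (+-identityʳ j) reached) (dip-¬IsAMG 0 j _ , Φ-toSeq-≡ (dip-end j R)))
    where
    S : ℕ → ℕ → Seq
    S a s = toSeq (dip a s (1 ∷ replicate a 1 ++ 2 ∷ R))
    moves : ∀ {a s} → suc a + s ≡ j → S (suc a) s ↦ S a (suc s)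
    moves {a} {s} _ = dip-¬IsAMG (suc a) s _ , Φ-toSeq-≡ (dip-step a s _)

  climb-all : ∀ n j → j + n ≡ K → Reached (T j) (toSeq (dip j 0 (blocks r (suc j) n))) →
    Reached (T K) (toSeq (dip K 0 (replicate r 1)))
  climb-all zero j j+0≡K reached =
    subst (λ m → Reached (T m) (toSeq (dip m 0 (replicate r 1)))) (trans (sym (+-identityʳ j)) j+0≡K) reached
  climb-all (suc n) j j+1+n≡K reached = climb-all n (suc j) (trans (sym (+-suc j n)) j+1+n≡K) (climb j _ reached)

  climb-to-K : Reached (T K) (toSeq (dip K 0 (replicate r 1)))
  climb-to-K = climb-all K 0 refl (start (Heaviside.B≡toSeq-blocks K r))

-- The marching group with a hole and a band

rot : List ℕ → List ℕ
rot [] = []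
rot (x ∷ xs) = xs ++ x ∷ []

rotate : ℕ → List ℕ → List ℕ
rotate zero xs = xs
rotate (suc n) xs = rotate n (rot xs)

length-rot : ∀ xs → length (rot xs) ≡ length xs
length-rot [] = refl
length-rot (x ∷ xs) = trans (length-++ xs) (+-comm (length xs) 1)

length-rotate : ∀ n xs → length (rotate n xs) ≡ length xs
length-rotate zero xs = refl
length-rotate (suc n) xs = trans (length-rotate n (rot xs)) (length-rot xs)

rot-rotate : ∀ n xs → rot (rotate n xs) ≡ rotate (suc n) xs
rot-rotate zero xs = refl
rot-rotate (suc n) xs = rot-rotate n (rot xs)

!-rot : ∀ xs {i} → suc i < length xs → rot xs ! i ≡ xs ! suc i
!-rot (x ∷ xs) (s≤s i<n) = !-++ˡ xs (x ∷ []) i<n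

!-rotate : ∀ n xs {i} → n + i < length xs → rotate n xs ! i ≡ xs ! (n + i)
!-rotate zero xs _ = refl
!-rotate (suc n) xs {i} n+i<len =
  trans (!-rotate n (rot xs) (subst (n + i <_) (sym (length-rot xs)) (<-trans (n<1+n (n + i)) n+i<len))) (!-rot xs n+i<len)

rotate-++ : ∀ xs ys → rotate (length xs) (xs ++ ys) ≡ ys ++ xs
rotate-++ [] ys = sym (++-identityʳ ys)
rotate-++ (x ∷ xs) ys = begin
  rotate (length xs) ((xs ++ ys) ++ x ∷ [])  ≡⟨ cong (rotate (length xs)) (++-assoc xs ys (x ∷ [])) ⟩
  rotate (length xs) (xs ++ ys ++ x ∷ [])    ≡⟨ rotate-++ xs (ys ++ x ∷ []) ⟩
  (ys ++ x ∷ []) ++ xs                       ≡⟨ ++-assoc ys (x ∷ []) xs ⟩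
  ys ++ x ∷ xs                               ∎
  where open ≡-Reasoning

HasOne : List ℕ → Set
HasOne xs = ∃[ p ] xs ! p ≡ 1

rotate-HasOne : ∀ n xs → HasOne xs → HasOne (rotate n xs)
rotate-HasOne zero xs one = one
rotate-HasOne (suc n) xs one = rotate-HasOne n (rot xs) (rot-HasOne xs one)
  where
  rot-HasOne : ∀ xs → HasOne xs → HasOne (rot xs)
  rot-HasOne (x ∷ xs) (zero , x≡1) = length xs , trans (!-++-length xs (x ∷ []) refl) x≡1
  rot-HasOne (x ∷ xs) (suc p , xs!p≡1) =
    p , trans (!-++ˡ xs (x ∷ []) (!≢0⇒< xs (λ xs!p≡0 → 0≢1+n (trans (sym xs!p≡0) xs!p≡1)))) xs!p≡1

Binary : List ℕ → Set
Binary xs = ∀ i → xs ! i ≤ 1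

Binary-++ : ∀ xs {ys} → Binary xs → Binary ys → Binary (xs ++ ys)
Binary-++ [] _ ys≤1 = ys≤1
Binary-++ (x ∷ xs) xs≤1 ys≤1 zero = xs≤1 zero
Binary-++ (x ∷ xs) xs≤1 ys≤1 (suc i) = Binary-++ xs (λ j → xs≤1 (suc j)) ys≤1 i

Binary-replicate : ∀ n {x} → x ≤ 1 → Binary (replicate n x)
Binary-replicate zero _ _ = z≤n
Binary-replicate (suc n) x≤1 zero = x≤1
Binary-replicate (suc n) x≤1 (suc i) = Binary-replicate n x≤1 i

holed : ℕ → ℕ → List ℕ
holed a u = replicate a 1 ++ 0 ∷ replicate u 1

length-holed : ∀ a u → length (holed a u) ≡ a + suc u
length-holed a u = trans (length-++ (replicate a 1)) (cong₂ _+_ (length-replicate a) (cong suc (length-replicate u)))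

!-holed : ∀ a u {p} → p ≤ a + u → p ≢ a → holed a u ! p ≡ 1
!-holed a u {p} p≤a+u p≢a with <-cmp p a
... | tri< p<a _ _ = !-replicate-++ˡ a 1 _ p<a
... | tri≈ _ p≡a _ = ⊥-elim (p≢a p≡a)
... | tri> _ _ a<p with m≤n⇒∃[o]m+o≡n a<p
...   | y , refl = trans (cong (holed a u !_) (sym (+-suc a y))) (trans (!-replicate-++ʳ a 1 _ (suc y)) (!-replicate u 1 y<u))
  where
  y<u : y < u
  y<u = +-cancelˡ-< a y u p≤a+u

Binary-holed : ∀ a u → Binary (holed a u)
Binary-holed a u = Binary-++ (replicate a 1) (Binary-replicate a ≤-refl) λ { zero → z≤n ; (suc i) → Binary-replicate u ≤-refl i }

holed-snoc : ∀ a u → holed a u ++ 1 ∷ [] ≡ holed a (suc u)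
holed-snoc a u = trans (++-assoc (replicate a 1) (0 ∷ replicate u 1) (1 ∷ []))
                       (cong (λ ys → replicate a 1 ++ 0 ∷ ys) (replicate-snoc u 1))

sow-bonus : ∀ {d e} q → d ≤ 1 → e ≤ d → (if suc q ≤ᵇ d + e then 1 else 0) ≡ (d ∷ e ∷ []) ! q
sow-bonus zero z≤n z≤n = refl
sow-bonus (suc zero) z≤n z≤n = refl
sow-bonus (suc (suc q)) z≤n z≤n = refl
sow-bonus zero (s≤s z≤n) z≤n = refl
sow-bonus (suc zero) (s≤s z≤n) z≤n = refl
sow-bonus (suc (suc q)) (s≤s z≤n) z≤n = refl
sow-bonus zero (s≤s z≤n) (s≤s z≤n) = refl
sow-bonus (suc zero) (s≤s z≤n) (s≤s z≤n) = refl
sow-bonus (suc (suc q)) (s≤s z≤n) (s≤s z≤n) = refl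

module Layered (K : ℕ) where

  layered : List ℕ → List ℕ → Seq
  layered D E = staircasePlus (suc K) (λ p → D ! p + E ! p)

  layered-¬IsAMG : ∀ {a u E p} → a + u ≡ suc K → E ! a ≡ 0 → E ! p ≡ 1 → ¬ IsAMG (layered (holed a u) E)
  layered-¬IsAMG {a} {u} {E} {p} a+u≡1+K E!a≡0 E!p≡1 =
    straddle⇒¬IsAMG (suc (suc K)) {suc a} {suc p} (s≤s z≤n) (s≤s z≤n) deficit excess
    where
    a≤1+K : a ≤ suc K
    a≤1+K = ≤-trans (m≤m+n a u) (≤-reflexive a+u≡1+K)
    deficit : layered (holed a u) E (suc a) < M (suc (suc K)) (suc a)
    deficit rewrite !-replicate-++ a 1 (0 ∷ replicate u 1) | E!a≡0 | M≡∸ (suc (suc K)) (suc a) | +-∸-assoc 1 a≤1+K =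
      s≤s (≤-reflexive (+-identityʳ _))
    excess : M (suc (suc K)) (suc p) < layered (holed a u) E (suc p)
    excess rewrite M≡∸ (suc (suc K)) (suc p) | E!p≡1 with p ≤? suc K
    ... | yes p≤1+K rewrite !-holed a u (≤-trans p≤1+K (≤-reflexive (sym a+u≡1+K))) (λ { refl → 0≢1+n (trans (sym E!a≡0) E!p≡1) })
                          | +-∸-assoc 1 p≤1+K = ≤-reflexive (+-comm 2 (suc K ∸ p))
    ... | no p≰1+K rewrite m≤n⇒m∸n≡0 (≰⇒> p≰1+K) | m≤n⇒m∸n≡0 (<⇒≤ (≰⇒> p≰1+K)) = m≤n+m 1 _

  Φ-layered-front : ∀ {d ds e es p} → length ds ≡ suc K → length es ≡ suc (suc K) → p ≤ K →
    Φ (layered (d ∷ ds) (e ∷ es)) (suc p) ≡ layered (ds ++ d ∷ []) (es ++ e ∷ []) (suc p)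
  Φ-layered-front {d} {ds} {e} {es} {p} |ds| |es| p≤K = begin
    Φ (layered (d ∷ ds) (e ∷ es)) (suc p)
      ≡⟨ Φ-below (layered (d ∷ ds) (e ∷ es)) (suc p) (s≤s (≤-trans p≤K (m≤m+n K (d + e)))) ⟩
    (K ∸ p) + (ds ! p + es ! p) + 1
      ≡⟨ +-comm _ 1 ⟩
    suc (K ∸ p) + (ds ! p + es ! p)
      ≡⟨ cong₂ _+_ (sym (+-∸-assoc 1 p≤K)) (cong₂ _+_ (sym (!-++ˡ ds _ p<|ds|)) (sym (!-++ˡ es _ p<|es|))) ⟩
    (suc K ∸ p) + ((ds ++ d ∷ []) ! p + (es ++ e ∷ []) ! p) ∎
    where
    open ≡-Reasoning
    p<|ds| : p < length ds
    p<|ds| = ≤-trans (s≤s p≤K) (≤-reflexive (sym |ds|))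
    p<|es| : p < length es
    p<|es| = ≤-trans (s≤s (≤-trans p≤K (n≤1+n K))) (≤-reflexive (sym |es|))

  Φ-layered-back : ∀ {d ds e ys x} q → length ds ≡ suc K → length ys ≡ suc K → d ≤ 1 → e ≤ d →
    Φ (layered (d ∷ ds) (e ∷ ys ∷ʳ x)) (suc (suc K + q)) ≡ layered (ds ++ d ∷ []) ((ys ∷ʳ x) ++ e ∷ []) (suc (suc K + q))
  Φ-layered-back {d} {ds} {e} {ys} {x} q |ds| |ys| d≤1 e≤d = begin
    Φ (layered (d ∷ ds) (e ∷ ys ∷ʳ x)) (suc (suc K + q))
      ≡⟨ Φ-past-head (layered (d ∷ ds) (e ∷ ys ∷ʳ x)) (suc K) (d + e) q refl ⟩
    layered (d ∷ ds) (e ∷ ys ∷ʳ x) (suc (suc (suc K + q))) + (if suc q ≤ᵇ d + e then 1 else 0)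
      ≡⟨ cong₂ _+_ old-back (sow-bonus q d≤1 e≤d) ⟩
    (x ∷ []) ! q + (d ∷ e ∷ []) ! q
      ≡⟨ swap q ⟩
    (d ∷ []) ! q + (x ∷ e ∷ []) ! q
      ≡⟨ sym new-back ⟩
    layered (ds ++ d ∷ []) ((ys ∷ʳ x) ++ e ∷ []) (suc (suc K + q)) ∎
    where
    open ≡-Reasoning
    old-back : layered (d ∷ ds) (e ∷ ys ∷ʳ x) (suc (suc (suc K + q))) ≡ (x ∷ []) ! q
    old-back = cong₂ _+_ (m≤n⇒m∸n≡0 (≤-trans (m≤m+n (suc K) q) (n≤1+n _)))
                         (cong₂ _+_ (!-beyond ds (≤-trans (≤-reflexive |ds|) (m≤m+n _ q))) (!-++ʳ-length ys (x ∷ []) q |ys|))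
    new-back : layered (ds ++ d ∷ []) ((ys ∷ʳ x) ++ e ∷ []) (suc (suc K + q)) ≡ (d ∷ []) ! q + (x ∷ e ∷ []) ! q
    new-back = cong₂ _+_ (m≤n⇒m∸n≡0 (m≤m+n (suc K) q))
                         (cong₂ _+_ (!-++ʳ-length ds (d ∷ []) q |ds|)
                                    (trans (cong (_! (suc K + q)) (∷ʳ-++ ys x (e ∷ []))) (!-++ʳ-length ys (x ∷ e ∷ []) q |ys|)))
    swap : ∀ q → (x ∷ []) ! q + (d ∷ e ∷ []) ! q ≡ (d ∷ []) ! q + (x ∷ e ∷ []) ! q
    swap zero = +-comm x d
    swap (suc zero) = refl
    swap (suc (suc q)) = refl

  -- The head K + 1 + d + e is sown along the staircase below it, and the d + e beans
  -- left over become the new last entries of D and E.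
  Φ-layered : ∀ {D E} → length D ≡ suc (suc K) → length E ≡ suc (suc (suc K)) → D ! 0 ≤ 1 → E ! 0 ≤ D ! 0 →
    Φ (layered D E) ≡ₛ layered (rot D) (rot E)
  Φ-layered {d ∷ ds} {e ∷ es} |D| |E| d≤1 e≤d (suc p) _ with p ≤? K
  ... | yes p≤K = Φ-layered-front {d} {ds} {e} {es} (suc-injective |D|) (suc-injective |E|) p≤K
  ... | no p≰K with m≤n⇒∃[o]m+o≡n (≰⇒> p≰K) | initLast es
  ...   | q , refl | ys ∷ʳ′ x = Φ-layered-back {d} {ds} {e} {ys} {x} q (suc-injective |D|) |ys| d≤1 e≤d
    where
    |ys| : length ys ≡ suc K
    |ys| = suc-injective (trans (+-comm 1 (length ys)) (trans (sym (length-++ ys)) (suc-injective |E|)))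

  layered-≡ₛ : ∀ {D D′ E E′} → D ≡ D′ → E ≡ E′ → layered D E ≡ₛ layered D′ E′
  layered-≡ₛ refl refl _ _ = refl

  D₀ : List ℕ
  D₀ = holed (suc K) 0

  holed-step : ∀ {a u E} → a + u ≡ suc K → length E ≡ suc (suc (suc K)) → E ! 0 ≤ 1 → E ! a ≡ 0 → HasOne E →
    layered (holed a u) E ↦ layered (rot (holed a u)) (rot E)
  holed-step {a} {u} {E} a+u≡1+K |E| E!0≤1 E!a≡0 (p , E!p≡1) =
    layered-¬IsAMG {a} {u} {E} a+u≡1+K E!a≡0 E!p≡1 ,
    Φ-layered {holed a u} {E} (trans (length-holed a u) (trans (+-suc a u) (cong suc a+u≡1+K))) |E| (head≤1 a) (head a E!a≡0)
    where
    head≤1 : ∀ a → holed a u ! 0 ≤ 1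
    head≤1 zero = z≤n
    head≤1 (suc a) = ≤-refl
    head : ∀ a → E ! a ≡ 0 → E ! 0 ≤ holed a u ! 0
    head zero E!0≡0 = ≤-reflexive E!0≡0
    head (suc a) _ = E!0≤1

  module Sweep (λ₀ : Seq) where
    open Run λ₀

    sweep : ∀ {a₀ u₀ E t} → a₀ + u₀ ≡ suc K → length E ≡ suc (suc (suc K)) → Binary E → HasOne E → E ! a₀ ≡ 0 →
      Reached t (layered (holed a₀ u₀) E) → Reached (t + suc a₀) (layered D₀ (rotate (suc a₀) E))
    sweep {a₀} {u₀} {E} {t} a₀+u₀≡1+K |E| binary one hole reached =
      retime (sym (+-suc t a₀)) (step (march S moves (+-identityʳ a₀) reached) last-move)
      where
      S : ℕ → ℕ → Seq
      S a n = layered (holed a (n + u₀)) (rotate n E)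

      rotated : ∀ n a {u} → a + u ≡ suc K → n + a ≡ a₀ →
        layered (holed a u) (rotate n E) ↦ layered (rot (holed a u)) (rot (rotate n E))
      rotated n a {u} a+u≡1+K n+a≡a₀ =
        holed-step {a} {u} {rotate n E} a+u≡1+K (trans (length-rotate n E) |E|)
                   (subst (_≤ 1) (sym (!-rotate n E (below-|E| n+0≤a₀))) (binary (n + 0)))
                   (trans (!-rotate n E (below-|E| (≤-reflexive n+a≡a₀))) (trans (cong (E !_) n+a≡a₀) hole))
                   (rotate-HasOne n E one)
        where
        below-|E| : ∀ {i} → i ≤ a₀ → i < length E
        below-|E| i≤a₀ = ≤-trans (s≤s (≤-trans i≤a₀ (≤-trans (m≤m+n a₀ u₀) (≤-reflexive a₀+u₀≡1+K))))
                                 (≤-trans (n≤1+n _) (≤-reflexive (sym |E|)))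
        n+0≤a₀ : n + 0 ≤ a₀
        n+0≤a₀ = ≤-trans (≤-reflexive (+-identityʳ n)) (≤-trans (m≤m+n n a) (≤-reflexive n+a≡a₀))

      moves : ∀ {a n} → suc a + n ≡ a₀ → S (suc a) n ↦ S a (suc n)
      moves {a} {n} 1+a+n≡a₀ = ↦-≡ₛ (rotated n (suc a) 1+a+n+u₀≡1+K (trans (+-comm n (suc a)) 1+a+n≡a₀))
                                   (layered-≡ₛ (holed-snoc a (n + u₀)) (rot-rotate n E))
        where
        1+a+n+u₀≡1+K : suc a + (n + u₀) ≡ suc K
        1+a+n+u₀≡1+K = trans (sym (+-assoc (suc a) n u₀)) (trans (cong (_+ u₀) 1+a+n≡a₀) a₀+u₀≡1+K)

      last-move : S 0 a₀ ↦ layered D₀ (rotate (suc a₀) E)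
      last-move = ↦-≡ₛ (rotated a₀ 0 a₀+u₀≡1+K (+-identityʳ a₀))
                       (layered-≡ₛ (cong (λ m → replicate m 1 ++ 0 ∷ []) a₀+u₀≡1+K) (rot-rotate a₀ E))

band : ℕ → ℕ → ℕ → List ℕ
band r m v = replicate m 0 ++ replicate (suc r) 1 ++ replicate (suc v) 0

length-band : ∀ r m v → length (band r m v) ≡ m + (suc r + suc v)
length-band r m v = trans (length-++ (replicate m 0))
  (cong₂ _+_ (length-replicate m)
             (trans (length-++ (replicate (suc r) 1)) (cong₂ _+_ (length-replicate (suc r)) (length-replicate (suc v)))))

Binary-band : ∀ r m v → Binary (band r m v)
Binary-band r m v = Binary-++ (replicate m 0) (Binary-replicate m z≤n)
                      (Binary-++ (replicate (suc r) 1) (Binary-replicate (suc r) ≤-refl) (Binary-replicate (suc v) z≤n))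

!-band-front : ∀ r m v {i} → i < m → band r m v ! i ≡ 0
!-band-front r m v = !-replicate-++ˡ m 0 _

!-band-one : ∀ r m v {i} → i < suc r → band r m v ! (m + i) ≡ 1
!-band-one r m v {i} i<1+r = trans (!-replicate-++ʳ m 0 _ i) (!-replicate-++ˡ (suc r) 1 _ i<1+r)

!-band-back : ∀ r m v i → band r m v ! (m + (suc r + i)) ≡ 0
!-band-back r m v i = trans (!-replicate-++ʳ m 0 _ (suc r + i)) (trans (!-replicate-++ʳ (suc r) 1 _ i) (!-replicate-0 (suc v) i))

rotate-band : ∀ r m v → rotate (m + (suc r + suc v)) (band r m (suc v)) ≡ band r (suc m) v
rotate-band r m v = begin
  rotate (m + (suc r + suc v)) (band r m (suc v))        ≡⟨ cong (rotate (m + (suc r + suc v))) band≡ ⟩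
  rotate (m + (suc r + suc v)) (band r m v ++ 0 ∷ [])    ≡⟨ cong (λ n → rotate n (band r m v ++ 0 ∷ [])) (sym (length-band r m v)) ⟩
  rotate (length (band r m v)) (band r m v ++ 0 ∷ [])    ≡⟨ rotate-++ (band r m v) (0 ∷ []) ⟩
  band r (suc m) v                                       ∎
  where
  open ≡-Reasoning
  band≡ : band r m (suc v) ≡ band r m v ++ 0 ∷ []
  band≡ = begin
    replicate m 0 ++ replicate (suc r) 1 ++ replicate (suc (suc v)) 0
      ≡⟨ cong (λ zs → replicate m 0 ++ replicate (suc r) 1 ++ zs) (sym (replicate-snoc (suc v) 0)) ⟩
    replicate m 0 ++ replicate (suc r) 1 ++ replicate (suc v) 0 ++ 0 ∷ []
      ≡⟨ cong (replicate m 0 ++_) (sym (++-assoc (replicate (suc r) 1) _ _)) ⟩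
    replicate m 0 ++ (replicate (suc r) 1 ++ replicate (suc v) 0) ++ 0 ∷ []
      ≡⟨ sym (++-assoc (replicate m 0) _ _) ⟩
    band r m v ++ 0 ∷ [] ∎

rotate-band-front : ∀ r m → rotate m (band r m 0) ≡ band r 0 m
rotate-band-front r m = begin
  rotate m (band r m 0)                                           ≡⟨ cong (λ n → rotate n (band r m 0)) (sym (length-replicate m)) ⟩
  rotate (length (replicate m 0)) (band r m 0)                    ≡⟨ rotate-++ (replicate m 0) _ ⟩
  (replicate (suc r) 1 ++ 0 ∷ []) ++ replicate m 0                ≡⟨ ++-assoc (replicate (suc r) 1) (0 ∷ []) _ ⟩
  band r 0 m                                                      ∎
  where open ≡-Reasoning

-- The depth of B

module Depth (r w : ℕ) where

  private
    K : ℕ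
    K = r + w

  open Layered K
  open Run (B (suc (suc K)) r)
  open Sweep (B (suc (suc K)) r)

  dip-tail : ∀ q → dip w r [] ! (suc w + q) ≡ stairs 1 (suc r) ! q
  dip-tail q = begin
    dip w r [] ! (suc w + q)                          ≡⟨ cong (dip w r [] !_) (sym (+-suc w q)) ⟩
    dip w r [] ! (w + suc q)                          ≡⟨ !-++ʳ-length (stairs (suc (suc r)) w) _ (suc q) (length-stairs _ w) ⟩
    (stairs 1 (suc r) ++ []) ! q                      ≡⟨ cong (_! q) (++-identityʳ (stairs 1 (suc r))) ⟩
    stairs 1 (suc r) ! q                              ∎
    where open ≡-Reasoning

  offset : ∀ q → suc K ∸ (suc w + q) ≡ r ∸ q
  offset q = trans (cong (_∸ (w + q)) (+-comm r w)) ([m+n]∸[m+o]≡n∸o w r q)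

  dip≡layered-front : ∀ {p} → p ≤ w → dip w r [] ! p ≡ layered (holed w (suc r)) (band r (suc w) 0) (suc p)
  dip≡layered-front {p} p≤w with m≤n⇒m<n∨m≡n p≤w
  ... | inj₁ p<w = begin
    dip w r [] ! p                     ≡⟨ !-++ˡ (stairs _ w) _ (≤-trans p<w (≤-reflexive (sym (length-stairs _ w)))) ⟩
    stairs (suc (suc r)) w ! p         ≡⟨ !-stairs _ w p<w ⟩
    suc (suc K) ∸ p                    ≡⟨ +-∸-assoc 1 (≤-trans p≤w (≤-trans (m≤n+m w r) (n≤1+n K))) ⟩
    1 + (suc K ∸ p)                    ≡⟨ +-comm 1 _ ⟩
    (suc K ∸ p) + 1                    ≡⟨ cong ((suc K ∸ p) +_) (sym (cong₂ _+_ on-ones off-band)) ⟩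
    layered (holed w (suc r)) (band r (suc w) 0) (suc p) ∎
    where
    open ≡-Reasoning
    on-ones : holed w (suc r) ! p ≡ 1
    on-ones = !-replicate-++ˡ w 1 _ p<w
    off-band : band r (suc w) 0 ! p ≡ 0
    off-band = !-band-front r (suc w) 0 (m<n⇒m<1+n p<w)
  ... | inj₂ refl = begin
    dip w r [] ! w                     ≡⟨ !-++-length (stairs (suc (suc r)) w) _ (length-stairs _ w) ⟩
    suc r                              ≡⟨ sym (+-identityʳ (suc r)) ⟩
    suc r + 0                          ≡⟨ cong₂ _+_ (sym (m+n∸n≡m (suc r) w)) (sym (cong₂ _+_ on-hole off-band)) ⟩
    layered (holed w (suc r)) (band r (suc w) 0) (suc w) ∎
    where
    open ≡-Reasoning
    on-hole : holed w (suc r) ! w ≡ 0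
    on-hole = !-replicate-++ w 1 _
    off-band : band r (suc w) 0 ! w ≡ 0
    off-band = !-band-front r (suc w) 0 (n<1+n w)

  dip≡layered-back : ∀ q → dip w r [] ! (suc w + q) ≡ layered (holed w (suc r)) (band r (suc w) 0) (suc (suc w + q))
  dip≡layered-back q with q <? suc r
  ... | yes q<1+r = begin
    dip w r [] ! (suc w + q)           ≡⟨ dip-tail q ⟩
    stairs 1 (suc r) ! q               ≡⟨ !-stairs 1 (suc r) q<1+r ⟩
    suc (suc r) ∸ q                    ≡⟨ +-∸-assoc 2 (s≤s⁻¹ q<1+r) ⟩
    2 + (r ∸ q)                        ≡⟨ +-comm 2 (r ∸ q) ⟩
    (r ∸ q) + 2                        ≡⟨ cong₂ _+_ (sym (offset q)) (sym (cong₂ _+_ on-ones (!-band-one r (suc w) 0 q<1+r))) ⟩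
    layered (holed w (suc r)) (band r (suc w) 0) (suc (suc w + q)) ∎
    where
    open ≡-Reasoning
    on-ones : holed w (suc r) ! (suc w + q) ≡ 1
    on-ones = !-holed w (suc r) (≤-trans (≤-reflexive (sym (+-suc w q))) (+-monoʳ-≤ w q<1+r))
                                (λ eq → <-irrefl (sym eq) (s≤s (m≤m+n w q)))
  ... | no q≮1+r with m≤n⇒∃[o]m+o≡n (≮⇒≥ q≮1+r)
  ...   | q′ , refl = begin
    dip w r [] ! (suc w + (suc r + q′))   ≡⟨ dip-tail (suc r + q′) ⟩
    stairs 1 (suc r) ! (suc r + q′)       ≡⟨ !-beyond (stairs 1 (suc r)) (≤-trans (≤-reflexive (length-stairs 1 (suc r))) (m≤m+n _ q′)) ⟩
    0                                     ≡⟨ sym (cong₂ _+_ no-staircase (cong₂ _+_ past-holed (!-band-back r (suc w) 0 q′))) ⟩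
    layered (holed w (suc r)) (band r (suc w) 0) (suc (suc w + (suc r + q′))) ∎
    where
    open ≡-Reasoning
    no-staircase : suc K ∸ (suc w + (suc r + q′)) ≡ 0
    no-staircase = trans (offset (suc r + q′)) (m≤n⇒m∸n≡0 (≤-trans (n≤1+n r) (m≤m+n _ q′)))
    past-holed : holed w (suc r) ! (suc w + (suc r + q′)) ≡ 0
    past-holed = !-beyond (holed w (suc r))
      (≤-trans (≤-reflexive (trans (length-holed w (suc r)) (+-suc w (suc r)))) (s≤s (+-monoʳ-≤ w (m≤m+n (suc r) q′))))

  dip≡layered : toSeq (dip w r []) ≡ₛ layered (holed w (suc r)) (band r (suc w) 0)
  dip≡layered (suc p) _ with p ≤? w
  ... | yes p≤w = dip≡layered-front p≤w
  ... | no p≰w with m≤n⇒∃[o]m+o≡n (≰⇒> p≰w)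
  ...   | q , refl = dip≡layered-back q

  absorb-ones : Reached (T K + r) (toSeq (dip w r []))
  absorb-ones = march S moves (+-identityʳ r) (Climbing.climb-to-K K r)
    where
    S : ℕ → ℕ → Seq
    S a s = toSeq (dip (a + w) s (replicate a 1))
    moves : ∀ {a s} → suc a + s ≡ r → S (suc a) s ↦ S a (suc s)
    moves {a} {s} _ = dip-¬IsAMG (suc a + w) s _ , Φ-toSeq-≡ (dip-step (a + w) s (replicate a 1))

  |band| : ∀ {m v} → m + v ≡ suc w → length (band r m v) ≡ suc (suc (suc K))
  |band| {m} {v} m+v≡1+w = begin
    length (band r m v)        ≡⟨ length-band r m v ⟩
    m + (suc r + suc v)        ≡⟨ solve (m ∷ r ∷ v ∷ []) ⟩
    suc (suc (r + (m + v)))    ≡⟨ cong (λ x → suc (suc (r + x))) m+v≡1+w ⟩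
    suc (suc (r + suc w))      ≡⟨ cong (λ x → suc (suc x)) (+-suc r w) ⟩
    suc (suc (suc K))          ∎
    where open ≡-Reasoning

  first-sweep : Reached (T K + r + suc w) (layered D₀ (band r 0 (suc w)))
  first-sweep =
    Reached-≡ₛ (sweep {w} {suc r} {band r (suc w) 0}
                      (trans (+-suc w r) (cong suc (+-comm w r)))
                      (|band| {suc w} {0} (+-identityʳ (suc w)))
                      (Binary-band r (suc w) 0)
                      (suc w + 0 , !-band-one r (suc w) 0 (s≤s z≤n))
                      (!-band-front r (suc w) 0 (n<1+n w))
                      (Reached-≡ₛ absorb-ones dip≡layered))
               (layered-≡ₛ {D₀} refl (rotate-band-front r (suc w)))

  rounds : Reached (T K + r + suc w + suc w * suc (suc K)) (layered D₀ (band r (suc w) 0))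
  rounds = run (suc (suc K)) (λ a s → layered D₀ (band r s a)) round {suc w} {0} (+-identityʳ (suc w)) first-sweep
    where
    round : ∀ {a s t} → suc a + s ≡ suc w → Reached t (layered D₀ (band r s (suc a))) →
      Reached (t + suc (suc K)) (layered D₀ (band r (suc s) a))
    round {a} {s} 1+a+s≡1+w reached =
      Reached-≡ₛ (sweep {suc K} {0} {band r s (suc a)}
                        (+-identityʳ (suc K))
                        (|band| {s} {suc a} s+1+a≡1+w)
                        (Binary-band r s (suc a))
                        (s + 0 , !-band-one r s (suc a) (s≤s z≤n))
                        hole reached)
                 (layered-≡ₛ {D₀} refl (trans (cong (λ n → rotate n (band r s (suc a))) round-length) (rotate-band r s a)))
      where
      open ≡-Reasoning
      s+1+a≡1+w : s + suc a ≡ suc w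
      s+1+a≡1+w = trans (+-comm s (suc a)) 1+a+s≡1+w
      K≡r+s+a : K ≡ r + (s + a)
      K≡r+s+a = cong (r +_) (sym (suc-injective (trans (sym (+-suc s a)) s+1+a≡1+w)))
      round-length : suc (suc K) ≡ s + (suc r + suc a)
      round-length = begin
        suc (suc K)                ≡⟨ cong (λ x → suc (suc x)) K≡r+s+a ⟩
        suc (suc (r + (s + a)))    ≡⟨ solve (r ∷ s ∷ a ∷ []) ⟩
        s + (suc r + suc a)        ∎
      hole : band r s (suc a) ! suc K ≡ 0
      hole = begin
        band r s (suc a) ! suc K                ≡⟨ cong (λ x → band r s (suc a) ! suc x) K≡r+s+a ⟩
        band r s (suc a) ! suc (r + (s + a))    ≡⟨ cong (band r s (suc a) !_) (solve (r ∷ s ∷ a ∷ [])) ⟩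
        band r s (suc a) ! (s + (suc r + a))    ≡⟨ !-band-back r s (suc a) a ⟩
        0                                       ∎

  lands : IsAMG (layered D₀ (band r (suc w) 0))
  lands = staircasePlus-IsAMG (suc K) (λ p → D₀ ! p + band r (suc w) 0 ! p) positive bounded vanishing
    where
    positive : ∀ p → p ≤ suc K → 1 ≤ D₀ ! p + band r (suc w) 0 ! p
    positive p p≤1+K with m≤n⇒m<n∨m≡n p≤1+K
    ... | inj₁ p<1+K = ≤-trans (≤-reflexive (sym (!-replicate-++ˡ (suc K) 1 _ p<1+K))) (m≤m+n _ _)
    ... | inj₂ refl = ≤-trans (≤-reflexive (sym last-one)) (m≤n+m _ _)
      where
      last-one : band r (suc w) 0 ! suc K ≡ 1
      last-one = trans (cong (λ x → band r (suc w) 0 ! suc x) (+-comm r w)) (!-band-one r (suc w) 0 (n<1+n r))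
    bounded : ∀ p → D₀ ! p + band r (suc w) 0 ! p ≤ 2
    bounded p = +-mono-≤ (Binary-holed (suc K) 0 p) (Binary-band r (suc w) 0 p)
    vanishing : ∀ p → suc K < p → D₀ ! p + band r (suc w) 0 ! p ≡ 0
    vanishing p 1+K<p with m≤n⇒∃[o]m+o≡n 1+K<p
    ... | q , refl = cong₂ _+_ (!-beyond D₀ (≤-trans (≤-reflexive (trans (length-holed (suc K) 0) (+-comm (suc K) 1))) 1+K<p))
                               (trans (cong (band r (suc w) 0 !_) (index q)) (!-band-back r (suc w) 0 q))
      where
      index : ∀ q → suc (suc (r + w)) + q ≡ suc w + (suc r + q)
      index q = solve (r ∷ w ∷ q ∷ [])

  depth : HasDepth (B (suc (suc K)) r) (T K + r + suc w + suc w * suc (suc K))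
  depth = Reached⇒HasDepth rounds lands

T-double : ∀ n → 2 * T n ≡ n * suc n
T-double zero = refl
T-double (suc n) = begin
  2 * (T n + suc n)        ≡⟨ *-distribˡ-+ 2 (T n) (suc n) ⟩
  2 * T n + 2 * suc n      ≡⟨ cong (_+ 2 * suc n) (T-double n) ⟩
  n * suc n + 2 * suc n    ≡⟨ solve (n ∷ []) ⟩
  suc n * suc (suc n)      ∎
  where open ≡-Reasoning

k∸r∸2 : ∀ r w → suc (suc (r + w)) ∸ r ∸ 2 ≡ w
k∸r∸2 zero w = refl
k∸r∸2 (suc r) w = k∸r∸2 r w

depth-as-phases : ∀ r w → T (suc (suc (r + w))) + suc (suc (r + w)) * w ≡ T (r + w) + r + suc w + suc w * suc (suc (r + w))
depth-as-phases r w = identity (T (r + w)) r w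
  where
  identity : ∀ t r w → t + suc (r + w) + suc (suc (r + w)) + suc (suc (r + w)) * w ≡ t + r + suc w + suc w * suc (suc (r + w))
  identity = solve-∀

depth-as-3T : ∀ r w → T (suc (suc (r + w))) + suc (suc (r + w)) * w ≡ 3 * T (suc (r + w)) ∸ r * suc (suc (r + w))
depth-as-3T r w = sym (trans (cong (_∸ r * k) three-T) (m+n∸n≡m _ (r * k)))
  where
  k : ℕ
  k = suc (suc (r + w))
  three-T : 3 * T (suc (r + w)) ≡ T k + k * w + r * k
  three-T = begin
    3 * T (suc (r + w))                          ≡⟨ triple (T (suc (r + w))) ⟩
    T (suc (r + w)) + 2 * T (suc (r + w))        ≡⟨ cong (T (suc (r + w)) +_) (T-double (suc (r + w))) ⟩
    T (suc (r + w)) + suc (r + w) * k            ≡⟨ identity (T (suc (r + w))) r w ⟩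
    T k + k * w + r * k                          ∎
    where
    open ≡-Reasoning
    identity : ∀ t r w → t + suc (r + w) * suc (suc (r + w)) ≡ t + suc (suc (r + w)) + suc (suc (r + w)) * w + r * suc (suc (r + w))
    identity = solve-∀
    triple : ∀ t → 3 * t ≡ t + 2 * t
    triple = solve-∀

mainTheorem12 : (k r : ℕ) → 2 ≤ k → r ≤ k ∸ 2 →
    HasDepth (B k r) (T k + k * (k ∸ r ∸ 2))
      × (T k + k * (k ∸ r ∸ 2) ≡ 3 * T (k ∸ 1) ∸ r * k)
mainTheorem12 (suc (suc K)) r (s≤s (s≤s z≤n)) r≤K with m≤n⇒∃[o]m+o≡n r≤K
... | w , refl rewrite k∸r∸2 r w =
  subst (HasDepth (B (suc (suc (r + w))) r)) (sym (depth-as-phases r w)) (Depth.depth r w) , depth-as-3T r w
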